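{- Let $d$ be a fixed positive integer. Then there is no 0-1-symmetric language $L\subseteq\{0,1\}^*$ such that $\mathcal{G}_L$ equals the class of all $d$-degenerate graphs; more generally, no class $\mathcal{G}$ of graphs that is a hereditary subclass of the class of $d$-degenerate graphs, other than the class $\{N_n\mid n\geq 1\}$ of all edgeless graphs, equals $\mathcal{G}_L$ for any 0-1-symmetric language $L\subseteq\{0,1\}^*$.
   Context: All graphs are finite, simple, undirected, with nonempty vertex sets, and graph classes are considered up to isomorphism. A graph is $d$-degenerate if every subgraph has a vertex of degree at most $d$. A class is hereditary if it is closed under induced subgraphs. $N_n$ is the edgeless graph on $n$ vertices. For $w\in\{0,1\}^*$ let $\widetilde{w}$ be obtained from $w$ by exchanging the letters 0 and 1; a language $L\subseteq\{0,1\}^*$ is 0-1-symmetric if $L=\{\widetilde w : w\in L\}$. For an alphabet $V$ and distinct $u,v\in V$, $h_{u,v}:V^*\to\{0,1\}^*$ is the monoid morphism with $u\mapsto 0$, $v\mapsto 1$ and $x\mapsto\lambda$ (empty word) for all other letters $x$. For a 0-1-symmetric $L$ and a nonempty word $w$ whose set of occurring letters is $V$, $G(L,w)$ is the graph with vertex set $V$ in which distinct $u,v$ are adjacent iff $h_{u,v}(w)\in L$. A graph is $L$-representable if it is isomorphic to some $G(L,w)$, and $\mathcal{G}_L$ denotes the class of all $L$-representable graphs. -}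

module Defs where

open import Data.Nat using (ℕ; zero; suc; _≤_)
open import Data.Fin using (Fin; _≟_)
open import Data.Bool using (Bool; true; false; not)
open import Data.List using (List; []; _∷_; map; _++_)
open import Data.List.Membership.Propositional using (_∈_)
open import Data.Product using (Σ; ∃; ∃-syntax; _×_; _,_; proj₁; proj₂)
open import Data.Empty using (⊥; ⊥-elim)
open import Relation.Nullary using (¬_; yes; no; Dec)
open import Relation.Binary.PropositionalEquality using (_≡_; _≢_; refl; sym; trans; cong)
open import Function using (_∘_)
open import Level using (Lift)
open import Function.Bundles using (_⇔_; _↔_; Equivalence; Inverse)
open import Function.Definitions using (Injective)

-- Finite simple graphs with nonempty vertex set Fin (suc order).
-- Adjacency is a Set-valued (not necessarily decidable) relation.

record Graph : Set₁ where
  field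
    order  : ℕ
    adj    : Fin (suc order) → Fin (suc order) → Set
    adjSym : ∀ {u v} → adj u v → adj v u
    irrefl : ∀ {u} → ¬ adj u u

open Graph public

V : Graph → Set
V G = Fin (suc (order G))

_≅_ : Graph → Graph → Set
G ≅ H = Σ (V G ↔ V H) λ f →
  ∀ u v → adj G u v ⇔ adj H (Inverse.to f u) (Inverse.to f v)

Class : Set₂
Class = Graph → Set₁

IsoClosed : Class → Set₁
IsoClosed 𝒢 = ∀ G H → G ≅ H → 𝒢 G → 𝒢 H

_≐_ : Class → Class → Set₁
𝒢 ≐ ℋ = ∀ G → 𝒢 G ⇔ ℋ G

IsSubgraph : Graph → Graph → Set
IsSubgraph H G = Σ (V H → V G) λ f →
  Injective _≡_ _≡_ f × (∀ u v → adj H u v → adj G (f u) (f v))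

IsInducedSubgraph : Graph → Graph → Set
IsInducedSubgraph H G = Σ (V H → V G) λ f →
  Injective _≡_ _≡_ f × (∀ u v → adj H u v ⇔ adj G (f u) (f v))

DegreeAtMost : (G : Graph) → V G → ℕ → Set
DegreeAtMost G v d =
  (f : Fin (suc d) → V G) → Injective _≡_ _≡_ f → ¬ (∀ i → adj G v (f i))

Degenerate : ℕ → Graph → Set₁
Degenerate d G = ∀ (H : Graph) → IsSubgraph H G → ∃[ v ] DegreeAtMost H v d

Hereditary : Class → Set₁
Hereditary 𝒢 = ∀ G H → IsInducedSubgraph H G → 𝒢 G → 𝒢 H

DegenerateClass : ℕ → Class
DegenerateClass d G = Degenerate d G

Edgeless : Class
Edgeless G = Lift _ (∀ u v → adj G u v → ⊥)

-- Languages over {0,1}; the letter 0 is false and 1 is true.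

Language : Set₁
Language = List Bool → Set

swap01 : List Bool → List Bool
swap01 = map not

ZeroOneSymmetric : Language → Set
ZeroOneSymmetric L = ∀ w → L w ⇔ (∃[ w' ] (L w' × w ≡ swap01 w'))

letter : ∀ {k} {x u v : Fin k} → Dec (x ≡ u) → Dec (x ≡ v) → List Bool
letter (yes _) _ = false ∷ []
letter (no _) (yes _) = true ∷ []
letter (no _) (no _) = []

h : ∀ {k} → Fin k → Fin k → List (Fin k) → List Bool
h u v [] = []
h u v (x ∷ w) = letter (x ≟ u) (x ≟ v) ++ h u v w

h-swap : ∀ {k} (u v : Fin k) → u ≢ v → ∀ w → h v u w ≡ swap01 (h u v w)
h-swap u v u≢v [] = refl
h-swap u v u≢v (x ∷ w) with x ≟ u | x ≟ v
... | yes refl | yes refl = ⊥-elim (u≢v refl)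
... | yes refl | no _ = cong (true ∷_) (h-swap u v u≢v w)
... | no _ | yes refl = cong (false ∷_) (h-swap u v u≢v w)
... | no _ | no _ = h-swap u v u≢v w

private
  from-sym : ∀ (L : Language) → ZeroOneSymmetric L → ∀ w → L w → L (swap01 w)
  from-sym L s w Lw = Equivalence.from (s (swap01 w)) (w , Lw , refl)

  GAdj : ∀ (L : Language) {m} → List (Fin (suc m)) → Fin (suc m) → Fin (suc m) → Set
  GAdj L w u v = (u ≢ v) × L (h u v w)

-- G(L,w) for a word w over the alphabet Fin (suc m) in which every letter
-- occurs (so the set of occurring letters is exactly the vertex set).
GL : (L : Language) → ZeroOneSymmetric L → (m : ℕ) → List (Fin (suc m)) → Graph
GL L s m w = record
  { order  = m
  ; adj    = GAdj L w
  ; adjSym = λ { {u} {v} (u≢v , Lh) →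
               (λ e → u≢v (sym e)) ,
               subst′ (sym (h-swap u v u≢v w)) (from-sym L s (h u v w) Lh) }
  ; irrefl = λ { (u≢u , _) → u≢u refl }
  }
  where
  subst′ : ∀ {a b} → a ≡ b → L a → L b
  subst′ refl x = x

Representable : (L : Language) → ZeroOneSymmetric L → Class
Representable L s G =
  Σ ℕ λ m → Σ (List (Fin (suc m))) λ w →
    Lift _ ((∀ x → x ∈ w) × (G ≅ GL L s m w))

{-# OPTIONS --safe #-}
-- If some L-representable graph has an edge u v, then p = h_{u,v}(w) ∈ L uses both letters.
-- Substituting the block a₁⋯a_{d+1} for every 0 and b₁⋯b_{d+1} for every 1 in p gives a word
-- W with h_{aᵢ,bⱼ}(W) = p for all i, j, so G(L, W) contains K_{d+1,d+1} on its whole vertex set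
-- and is not d-degenerate. Hence if 𝒢_L consists of d-degenerate graphs, all its members are
-- edgeless, and conversely every edgeless graph is G(L, w) for a word w listing its vertices.
-- So 𝒢_L is the class of edgeless graphs, which misses the d-degenerate graph K₂ when d ≥ 1.
module Submission where

open import Defs
open import Data.Nat using (ℕ; suc; _≤_; _+_)
open import Data.Nat.Properties using (≤-trans; ≤-pred; ≤⇒≯)
open import Data.Fin using (Fin; zero; suc; _≟_; _↑ˡ_; _↑ʳ_; splitAt; punchOut)
open import Data.Fin.Properties
  using (0≢1+n; suc-injective; ↑ˡ-injective; ↑ʳ-injective; splitAt-↑ˡ; splitAt-↑ʳ;
         splitAt⁻¹-↑ˡ; splitAt⁻¹-↑ʳ; punchOut-injective; injective⇒≤)
open import Data.Bool using (Bool; true; false; not)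
open import Data.List using (List; []; _∷_; _++_; tabulate; concatMap; allFin)
open import Data.List.Properties using (++-assoc)
open import Data.List.Membership.Propositional using (_∈_; _∉_)
open import Data.List.Membership.Propositional.Properties
  using (∈-++⁺ʳ; ∈-map⁺; ∈-tabulate⁺; ∈-tabulate⁻; ∈-concatMap⁺; ∈-allFin)
open import Data.List.Relation.Unary.Any as Any using (here; there)
open import Data.Product using (Σ; ∃-syntax; _×_; _,_)
open import Data.Sum using (inj₁; inj₂)
open import Relation.Nullary using (¬_; yes; no; contradiction)
open import Relation.Binary.PropositionalEquality
  using (_≡_; _≢_; refl; sym; trans; cong; cong₂; subst; module ≡-Reasoning)
open import Function using (_∘_; id)
open import Function.Bundles using (_↔_; Equivalence; Inverse; mk⇔)
open import Function.Definitions using (Injective)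
open import Function.Construct.Identity using (↔-id; ⇔-id)
open import Function.Construct.Composition using (_⇔-∘_)
open import Function.Construct.Symmetry using (⇔-sym)
open import Level using (lift; lower)

open ≡-Reasoning

module _ {k : ℕ} where

  h-++ : ∀ (u v : Fin k) xs ys → h u v (xs ++ ys) ≡ h u v xs ++ h u v ys
  h-++ u v [] ys = refl
  h-++ u v (x ∷ xs) ys = begin
    letter (x ≟ u) (x ≟ v) ++ h u v (xs ++ ys)          ≡⟨ cong (letter (x ≟ u) (x ≟ v) ++_) (h-++ u v xs ys) ⟩
    letter (x ≟ u) (x ≟ v) ++ (h u v xs ++ h u v ys)    ≡⟨ ++-assoc (letter (x ≟ u) (x ≟ v)) (h u v xs) (h u v ys) ⟨
    (letter (x ≟ u) (x ≟ v) ++ h u v xs) ++ h u v ys    ∎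

  false∈h : ∀ {u v : Fin k} {w} → u ∈ w → false ∈ h u v w
  false∈h {u} {v} {x ∷ w} u∈w with x ≟ u | u∈w
  ... | yes _ | _         = here refl
  ... | no x≢u | here x≡u = contradiction (sym x≡u) x≢u
  ... | no _  | there u∈  = ∈-++⁺ʳ (letter (no _) (x ≟ v)) (false∈h u∈)

  true∈h : ∀ {u v : Fin k} {w} → u ≢ v → v ∈ w → true ∈ h u v w
  true∈h {u} {v} {w} u≢v v∈w =
    subst (true ∈_) (sym (h-swap v u (u≢v ∘ sym) w)) (∈-map⁺ not (false∈h v∈w))

  h-∉ : ∀ {u v : Fin k} {w} → u ∉ w → v ∉ w → h u v w ≡ []
  h-∉ {w = []} _ _ = refl
  h-∉ {u} {v} {x ∷ w} u∉ v∉ with x ≟ u | x ≟ v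
  ... | yes refl | _        = contradiction (here refl) u∉
  ... | no _     | yes refl = contradiction (here refl) v∉
  ... | no _     | no _     = h-∉ (u∉ ∘ there) (v∉ ∘ there)

  h-tabulate : ∀ {n} (f : Fin n → Fin k) {v} → Injective _≡_ _≡_ f → (∀ i → f i ≢ v) →
               ∀ i → h (f i) v (tabulate f) ≡ false ∷ []
  h-tabulate f {v} f-inj f≢v zero with f zero ≟ f zero
  ... | yes _ = cong (false ∷_) (h-∉ f₀∉ v∉)
    where
    f₀∉ : f zero ∉ tabulate (f ∘ suc)
    f₀∉ f₀∈ with _ , f₀≡ ← ∈-tabulate⁻ f₀∈ = 0≢1+n (f-inj f₀≡)
    v∉ : v ∉ tabulate (f ∘ suc)
    v∉ v∈ with i , v≡ ← ∈-tabulate⁻ v∈ = f≢v (suc i) (sym v≡)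
  ... | no f₀≢f₀ = contradiction refl f₀≢f₀
  h-tabulate f {v} f-inj f≢v (suc i) with f zero ≟ f (suc i) | f zero ≟ v
  ... | yes f₀≡ | _     = contradiction (f-inj f₀≡) 0≢1+n
  ... | no _    | yes e = contradiction e (f≢v zero)
  ... | no _    | no _  = h-tabulate (f ∘ suc) (suc-injective ∘ f-inj) (f≢v ∘ suc) i

module BlowUp (n : ℕ) where

  a b : Fin n → Fin (n + n)
  a i = i ↑ˡ n
  b j = n ↑ʳ j

  a≢b : ∀ i j → a i ≢ b j
  a≢b i j a≡b with () ← trans (sym (splitAt-↑ˡ n i n)) (trans (cong (splitAt n) a≡b) (splitAt-↑ʳ n n j))

  data Side : Fin (n + n) → Set where
    left  : ∀ i → Side (a i)
    right : ∀ j → Side (b j)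

  side : ∀ y → Side y
  side y with splitAt n y in eq
  ... | inj₁ i = subst Side (splitAt⁻¹-↑ˡ eq) (left i)
  ... | inj₂ j = subst Side (splitAt⁻¹-↑ʳ eq) (right j)

  block : Bool → List (Fin (n + n))
  block false = tabulate a
  block true  = tabulate b

  blowUp : List Bool → List (Fin (n + n))
  blowUp = concatMap block

  h-block : ∀ i j x → h (a i) (b j) (block x) ≡ x ∷ []
  h-block i j false = h-tabulate a (↑ˡ-injective n _ _) (λ k → a≢b k j) i
  h-block i j true  = begin
    h (a i) (b j) (tabulate b)          ≡⟨ h-swap (b j) (a i) (a≢b i j ∘ sym) (tabulate b) ⟩
    swap01 (h (b j) (a i) (tabulate b)) ≡⟨ cong swap01 (h-tabulate b (↑ʳ-injective n _ _) (λ k → a≢b i k ∘ sym) j) ⟩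
    true ∷ []                           ∎

  h-blowUp : ∀ i j p → h (a i) (b j) (blowUp p) ≡ p
  h-blowUp i j []      = refl
  h-blowUp i j (x ∷ p) = begin
    h (a i) (b j) (block x ++ blowUp p)                 ≡⟨ h-++ (a i) (b j) (block x) (blowUp p) ⟩
    h (a i) (b j) (block x) ++ h (a i) (b j) (blowUp p) ≡⟨ cong₂ _++_ (h-block i j x) (h-blowUp i j p) ⟩
    x ∷ p                                               ∎

  ∈-block : ∀ y → ∃[ x ] y ∈ block x
  ∈-block y with side y
  ... | left i  = false , ∈-tabulate⁺ i
  ... | right j = true  , ∈-tabulate⁺ j

  ∈-blowUp : ∀ {p} → (∀ x → x ∈ p) → ∀ y → y ∈ blowUp p
  ∈-blowUp p-full y with x , y∈ ← ∈-block y = ∈-concatMap⁺ block (Any.map (λ { refl → y∈ }) (p-full x))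

Neighbours : (G : Graph) → V G → ℕ → Set
Neighbours G v k = Σ (Fin k → V G) λ f → Injective _≡_ _≡_ f × (∀ i → adj G v (f i))

neighbours⇒¬degenerate : ∀ {d} G → (∀ v → Neighbours G v (suc d)) → ¬ Degenerate d G
neighbours⇒¬degenerate G nbrs deg with v , v-deg ← deg G (id , id , λ _ _ → id)
  with f , f-inj , v~f ← nbrs v = v-deg f f-inj v~f

degreeAtMost-order : ∀ {d} G v → order G ≤ d → DegreeAtMost G v d
degreeAtMost-order {d} G v order≤d f f-inj v~f = ≤⇒≯ order≤d (injective⇒≤ g-inj)
  where
  v≢f : ∀ i → v ≢ f i
  v≢f i v≡fi = irrefl G (subst (adj G v) (sym v≡fi) (v~f i))

  g : Fin (suc d) → Fin (order G)
  g i = punchOut (v≢f i)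

  g-inj : Injective _≡_ _≡_ g
  g-inj = f-inj ∘ punchOut-injective (v≢f _) (v≢f _)

order≤⇒degenerate : ∀ {d} G → order G ≤ d → Degenerate d G
order≤⇒degenerate G order≤d H (f , f-inj , _) =
  zero , degreeAtMost-order H zero (≤-trans (≤-pred (injective⇒≤ f-inj)) order≤d)

K₂ : Graph
K₂ = record
  { order  = 1
  ; adj    = _≢_
  ; adjSym = _∘ sym
  ; irrefl = λ u≢u → u≢u refl
  }

edgeless-≅ : ∀ G H → V G ↔ V H → (∀ u v → ¬ adj G u v) → (∀ u v → ¬ adj H u v) → G ≅ H
edgeless-≅ G H e G-edgeless H-edgeless =
  e , λ u v → mk⇔ (λ u~v → contradiction u~v (G-edgeless u v))
                  (λ u~v → contradiction u~v (H-edgeless _ _))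

module _ (L : Language) (s : ZeroOneSymmetric L) where

  GL-representable : ∀ m w → (∀ x → x ∈ w) → Representable L s (GL L s m w)
  GL-representable m w w-full = m , w , lift (w-full , ↔-id _ , λ _ _ → ⇔-id _)

  edge⇒fullWord : ∀ G {u v} → Representable L s G → adj G u v → ∃[ p ] L p × (∀ x → x ∈ p)
  edge⇒fullWord G {u} {v} (m , w , lift (w-full , iso , adj⇔)) u~v
    with u′≢v′ , Lp ← Equivalence.to (adj⇔ u v) u~v =
    h u′ v′ w , Lp , λ { false → false∈h (w-full u′) ; true → true∈h u′≢v′ (w-full v′) }
    where
    u′ = Inverse.to iso u
    v′ = Inverse.to iso v

  module _ (d : ℕ) where
    open BlowUp (suc d)

    blowUpGraph : List Bool → Graph
    blowUpGraph p = GL L s (d + suc d) (blowUp p)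

    blowUp-complete : ∀ {p} → L p → ∀ i j → adj (blowUpGraph p) (a i) (b j)
    blowUp-complete {p} Lp i j = a≢b i j , subst L (sym (h-blowUp i j p)) Lp

    blowUp-neighbours : ∀ {p} → L p → ∀ y → Neighbours (blowUpGraph p) y (suc d)
    blowUp-neighbours {p} Lp y with side y
    ... | left i  = b , ↑ʳ-injective (suc d) _ _ , blowUp-complete Lp i
    ... | right j = a , ↑ˡ-injective (suc d) _ _ , λ i → adjSym (blowUpGraph p) (blowUp-complete Lp i j)

    fullWord⇒¬degenerate : ∀ {p} → L p → (∀ x → x ∈ p) →
                           ¬ (∀ G → Representable L s G → Degenerate d G)
    fullWord⇒¬degenerate {p} Lp p-full deg =
      neighbours⇒¬degenerate (blowUpGraph p) (blowUp-neighbours Lp)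
        (deg (blowUpGraph p) (GL-representable (d + suc d) (blowUp p) (∈-blowUp p-full)))

  degenerate⇒edgeless : ∀ d → (∀ G → Representable L s G → Degenerate d G) →
                        ∀ G → Representable L s G → ∀ u v → ¬ adj G u v
  degenerate⇒edgeless d deg G G-rep u v u~v with p , Lp , p-full ← edge⇒fullWord G G-rep u~v =
    fullWord⇒¬degenerate d Lp p-full deg

  representable≐edgeless : ∀ d → (∀ G → Representable L s G → Degenerate d G) →
                           Representable L s ≐ Edgeless
  representable≐edgeless d deg G = mk⇔ (lift ∘ degenerate⇒edgeless d deg G) λ G-edgeless →
    order G , allFin _ , lift (∈-allFin , edgeless-≅ G G′ (↔-id _) (lower G-edgeless) G′-edgeless)
    where
    G′ : Graph
    G′ = GL L s (order G) (allFin _)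

    G′-edgeless : ∀ u v → ¬ adj G′ u v
    G′-edgeless = degenerate⇒edgeless d deg G′ (GL-representable (order G) (allFin _) ∈-allFin)

mainTheorem6 : (d : ℕ) → 1 ≤ d →
    ((L : Language) (s : ZeroOneSymmetric L) → ¬ (Representable L s ≐ DegenerateClass d))
    × ((𝒢 : Class) → IsoClosed 𝒢 → Hereditary 𝒢 → (∀ G → 𝒢 G → Degenerate d G) →
       ¬ (𝒢 ≐ Edgeless) →
       (L : Language) (s : ZeroOneSymmetric L) → ¬ (Representable L s ≐ 𝒢))
mainTheorem6 d 1≤d = not-degenerateClass , not-subclass
  where
  not-degenerateClass : (L : Language) (s : ZeroOneSymmetric L) → ¬ (Representable L s ≐ DegenerateClass d)
  not-degenerateClass L s 𝒢L≐deg = lower (Equivalence.to (𝒢L≐edgeless K₂) K₂-rep) zero (suc zero) 0≢1+n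
    where
    𝒢L≐edgeless : Representable L s ≐ Edgeless
    𝒢L≐edgeless = representable≐edgeless L s d (λ G → Equivalence.to (𝒢L≐deg G))

    K₂-rep : Representable L s K₂
    K₂-rep = Equivalence.from (𝒢L≐deg K₂) (order≤⇒degenerate K₂ 1≤d)

  not-subclass : (𝒢 : Class) → IsoClosed 𝒢 → Hereditary 𝒢 → (∀ G → 𝒢 G → Degenerate d G) →
                 ¬ (𝒢 ≐ Edgeless) →
                 (L : Language) (s : ZeroOneSymmetric L) → ¬ (Representable L s ≐ 𝒢)
  not-subclass 𝒢 _ _ 𝒢-degenerate 𝒢≉edgeless L s 𝒢L≐𝒢 =
    𝒢≉edgeless λ G → 𝒢L≐edgeless G ⇔-∘ ⇔-sym (𝒢L≐𝒢 G)
    where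
    𝒢L≐edgeless : Representable L s ≐ Edgeless
    𝒢L≐edgeless = representable≐edgeless L s d (λ G → 𝒢-degenerate G ∘ Equivalence.to (𝒢L≐𝒢 G))
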